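{- Let $G=(V,E)$ be a graph and let $\mathcal{P}=(V_{u,v}\mid (u,v)\in V\times V)$ be a semi-smooth T-partition system on $G$. Then the groupoid associated with $\mathcal{P}$ is a semi-smooth travel groupoid on $G$.
   Context: Graphs are undirected, possibly infinite, with no loops and no multiple edges. For $u\in V$, $N_G[u]=\{u\}\cup\{v\mid\{u,v\}\in E\}$. A T-partition system on $G$ is a family $(V_{u,v}\subseteq V\mid (u,v)\in V\times V)$ such that: (P0) for every $u$, $\{V_{u,v}\mid v\in N_G[u]\}$ is a partition of $V$; (P1a) $V_{u,u}=\{u\}$; (P1b) for $u\neq v$: $v\in V_{u,v}$ iff $\{u,v\}\in E$; (P1c) for $u\neq v$: $V_{u,v}=\emptyset$ iff $\{u,v\}\notin E$; (P2) for $u\neq v$: $V_{u,v}\cap V_{v,u}=\emptyset$. It is semi-smooth if (R5): for all $u,v,x,y,z,w\in V$, if $x,y\in V_{u,v}$ and $x\in V_{y,z}\cap V_{z,w}$ then $z\in V_{u,v}$ or $w\in V_{u,v}$. The groupoid associated with a T-partition system is $(V,*)$ where $u*v$ is the unique $w$ with $v\in V_{u,w}$. A travel groupoid is a nonempty set $V$ with binary operation $*$ satisfying (t1) $(u*v)*u=u$ for all $u,v$ and (t2) if $(u*v)*v=u$ then $u=v$; it is on $G$ if $V(G)=V$ and $E(G)=\{\{u,v\}\mid u\neq v,\ u*v=v\}$; it is semi-smooth if for all $u,v,w$, $u*v=u*w$ implies $u*(v*w)=u*v$ or $u*((v*w)*w)=u*v$. -}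

module Defs where

open import Level using (Level; _⊔_; suc)
open import Data.Product using (Σ; _×_; _,_; proj₁; proj₂; ∃)
open import Data.Sum using (_⊎_)
open import Data.Empty using (⊥)
open import Relation.Nullary using (¬_)
open import Relation.Binary.PropositionalEquality using (_≡_)

record Graph (a ℓ : Level) : Set (suc (a ⊔ ℓ)) where
  field
    V     : Set a
    E     : V → V → Set ℓ
    irrefl : ∀ {u} → ¬ E u u
    sym    : ∀ {u v} → E u v → E v u

module _ {a ℓ : Level} (G : Graph a ℓ) where
  open Graph G

  InN : V → V → Set (a ⊔ ℓ)
  InN u v = (u ≡ v) ⊎ Lift′ (E u v)
    where
      open import Level using (Lift)
      Lift′ : Set ℓ → Set (a ⊔ ℓ)
      Lift′ A = Lift a A

  record TPartitionSystem (p : Level) : Set (a ⊔ ℓ ⊔ suc p) where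
    field
      Vs : V → V → V → Set p     -- Vs u v x  means  x ∈ V_{u,v}
      P0-cover    : ∀ u x → Σ V (λ w → InN u w × Vs u w x)
      P0-disjoint : ∀ u w w' x → InN u w → InN u w' → Vs u w x → Vs u w' x → w ≡ w'
      P1a : ∀ u x → (Vs u u x → x ≡ u) × (x ≡ u → Vs u u x)
      P1b : ∀ u v → ¬ u ≡ v → (Vs u v v → E u v) × (E u v → Vs u v v)
      P1c : ∀ u v → ¬ u ≡ v → ((∀ x → ¬ Vs u v x) → ¬ E u v) × (¬ E u v → ∀ x → ¬ Vs u v x)
      P2  : ∀ u v → ¬ u ≡ v → ∀ x → Vs u v x → Vs v u x → ⊥

    -- The associated groupoid: u * v is the unique w with v ∈ V_{u,w}
    -- (unique by P0; chosen via the cover witness).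
    _*_ : V → V → V
    u * v = proj₁ (P0-cover u v)

    SemiSmooth : Set (a ⊔ p)
    SemiSmooth = ∀ u v x y z w → Vs u v x → Vs u v y → Vs y z x → Vs z w x →
                 Vs u v z ⊎ Vs u v w

module _ {a : Level} {A : Set a} where
  record IsTravelGroupoid (_∙_ : A → A → A) : Set a where
    field
      nonempty : A
      t1 : ∀ u v → (u ∙ v) ∙ u ≡ u
      t2 : ∀ u v → (u ∙ v) ∙ v ≡ u → u ≡ v

  IsSemiSmoothOp : (A → A → A) → Set a
  IsSemiSmoothOp _∙_ = ∀ u v w → u ∙ v ≡ u ∙ w →
                       (u ∙ (v ∙ w) ≡ u ∙ v) ⊎ (u ∙ ((v ∙ w) ∙ w) ≡ u ∙ v)

module _ {a ℓ : Level} (G : Graph a ℓ) where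
  open Graph G
  IsOnGraph : (V → V → V) → Set (a ⊔ ℓ)
  IsOnGraph _∙_ = ∀ u v → (E u v → ¬ u ≡ v × u ∙ v ≡ v) × (¬ u ≡ v × u ∙ v ≡ v → E u v)

  IsSemiSmoothTravelGroupoidOn : (V → V → V) → Set (a ⊔ ℓ)
  IsSemiSmoothTravelGroupoidOn _∙_ =
    IsTravelGroupoid _∙_ × IsOnGraph _∙_ × IsSemiSmoothOp _∙_

module Submission where

-- Everything rests on one characterisation of the operation: u * v is the
-- unique w ∈ N[u] with v ∈ V_{u,w}.  The cover part of (P0) says u * v lies in
-- N[u] and v ∈ V_{u,u*v}; the disjointness part says any w ∈ N[u] with
-- v ∈ V_{u,w} equals u * v ('*-unique').  From this:
--   * (P1a) gives u * u = u, and (P1b) gives u * v = v for every edge uv;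
--   * (t1): u * v is u or a neighbour of u, and in both cases (u * v) * u = u;
--   * (t2): if u * v is a neighbour w of u, then v ∈ V_{u,w}, and
--     (u * v) * v = u would put v in V_{w,u}, contradicting (P2);
--   * "on G": u * v = v with u ≠ v means v ∈ V_{u,v}, an edge by (P1b);
--   * semi-smoothness: if u * v = u * w, then v, w ∈ V_{u,u*v}, and (R5)
--     applied with y = v, z = v * w, w' = (v * w) * w places one of them in
--     V_{u,u*v}, so by uniqueness u's step towards it is u * v.

open import Defs
open import Level using (Level; lift)
open import Data.Product using (_×_; _,_; proj₁; proj₂)
open import Data.Sum using (_⊎_; inj₁; inj₂)
open import Data.Empty using (⊥-elim)
open import Relation.Nullary using (¬_)
open import Relation.Binary.PropositionalEquality using (_≡_; refl; sym; subst)

module AssociatedGroupoid {a ℓ p : Level} (G : Graph a ℓ) (P : TPartitionSystem G p) where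
  open Graph G renaming (sym to E-sym)
  open TPartitionSystem P

  edge⇒≢ : ∀ {u v} → E u v → ¬ u ≡ v
  edge⇒≢ e refl = irrefl e

  *-inN : ∀ u v → InN G u (u * v)
  *-inN u v = proj₁ (proj₂ (P0-cover u v))

  ∈V-* : ∀ u v → Vs u (u * v) v
  ∈V-* u v = proj₂ (proj₂ (P0-cover u v))

  *-unique : ∀ {u w v} → InN G u w → Vs u w v → u * v ≡ w
  *-unique {u} {w} {v} w∈N v∈V = P0-disjoint u (u * v) w v (*-inN u v) w∈N (∈V-* u v) v∈V

  *≡⇒∈V : ∀ {u v w} → u * v ≡ w → Vs u w v
  *≡⇒∈V {u} {v} eq = subst (λ t → Vs u t v) eq (∈V-* u v)

  *-idem : ∀ u → u * u ≡ u
  *-idem u = *-unique (inj₁ refl) (proj₂ (P1a u u) refl)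

  *-edge : ∀ {u v} → E u v → u * v ≡ v
  *-edge {u} {v} e = *-unique (inj₂ (lift e)) (proj₂ (P1b u v (edge⇒≢ e)) e)

  t1 : ∀ u v → (u * v) * u ≡ u
  t1 u v with u * v | *-inN u v
  ... | _ | inj₁ refl     = *-idem u
  ... | _ | inj₂ (lift e) = *-edge (E-sym e)

  -- (t2): if u * v = w is a neighbour and w * v = u, then v ∈ V_{u,w} ∩ V_{w,u},
  -- contradicting (P2); otherwise u * v = u forces v = u by (P1a).
  t2 : ∀ u v → (u * v) * v ≡ u → u ≡ v
  t2 u v back with u * v | *-inN u v | ∈V-* u v
  ... | _ | inj₁ refl     | v∈Vuu = sym (proj₁ (P1a u v) v∈Vuu)
  ... | w | inj₂ (lift e) | v∈Vuw = ⊥-elim (P2 u w (edge⇒≢ e) v v∈Vuw (*≡⇒∈V back))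

  on-graph : IsOnGraph G _*_
  on-graph u v = (λ e → edge⇒≢ e , *-edge e)
               , λ { (u≢v , uv≡v) → proj₁ (P1b u v u≢v) (*≡⇒∈V uv≡v) }

  semi-smooth : SemiSmooth → IsSemiSmoothOp _*_
  semi-smooth R5 u v w uv≡uw
    with R5 u (u * v) w v (v * w) ((v * w) * w)
            (*≡⇒∈V (sym uv≡uw)) (∈V-* u v) (∈V-* v w) (∈V-* (v * w) w)
  ... | inj₁ vw∈V  = inj₁ (*-unique (*-inN u v) vw∈V)
  ... | inj₂ vww∈V = inj₂ (*-unique (*-inN u v) vww∈V)

lemma4p14 : {a ℓ p : Level} (G : Graph a ℓ) → Graph.V G →
            (P : TPartitionSystem G p) → TPartitionSystem.SemiSmooth P →
            IsSemiSmoothTravelGroupoidOn G (TPartitionSystem._*_ P)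
lemma4p14 G x P R5 =
  record { nonempty = x ; t1 = t1 ; t2 = t2 } , on-graph , semi-smooth R5
  where open AssociatedGroupoid G P
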